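{- Let $n \ge 1$ and let $m, r \ge 0$ be integers. Write $m = Mn + m_0$ and $r = Rn + r_0$ with integers $M, R \ge 0$ and $0 \le m_0, r_0 < n$. Then \[\sum_{d\mid n}\varphi\!\left(\frac{n}{d}\right)\sum_{j=-(d-1)}^{d-1}\ \sum_{\substack{\alpha\in\mathbb{N}^d\\ \|\alpha\|_d = R - j/d}}\binom{M}{\alpha_1}\cdots\binom{M}{\alpha_d}\binom{m_0}{r_0 + (n/d)j} \equiv 0 \pmod n,\] where the outer sum runs over the positive divisors $d$ of $n$ and $\varphi$ is Euler's totient function.
   Context: $\mathbb{N} = \{0,1,2,\dots\}$. For $\alpha = (\alpha_1,\dots,\alpha_d) \in \mathbb{N}^d$, the length is defined by $\|\alpha\|_d = \frac{1}{d}\sum_{i=1}^d \alpha_i$; the innermost sum is over all $\alpha\in\mathbb{N}^d$ with $\|\alpha\|_d = R - j/d$ (i.e. $\alpha_1+\cdots+\alpha_d = dR - j$). Binomial coefficients follow the convention $\binom{a}{b} = 0$ whenever $b > a$ or $b < 0$. -}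

module Defs where

open import Data.Nat using (ℕ; zero; suc; _+_; _*_; _∸_; NonZero)
open import Data.Nat.Properties using (_≟_)
open import Data.Nat.GCD using (gcd)
open import Data.Nat.Divisibility using (_∣?_)
open import Data.Nat.DivMod using (_/_)
open import Data.Nat.Combinatorics using (_C_)
open import Data.Integer as ℤ using (ℤ; +_; -[1+_])
open import Data.Nat.ListAction using (sum)
open import Data.List using (List; []; _∷_; map; upTo; filter; concatMap; length)
open import Data.Vec using (Vec; []; _∷_; foldr)
open import Data.Vec as Vec using ()
open import Relation.Nullary.Decidable using (does)
open import Data.Bool using (if_then_else_)

φ : ℕ → ℕ
φ k = length (filter (λ i → gcd i k ≟ 1) (map suc (upTo k)))

divisors : ℕ → List ℕ
divisors n = filter (λ d → d ∣? n) (map suc (upTo n))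

sumDiv : (n : ℕ) → ((d : ℕ) → .{{NonZero d}} → ℕ) → ℕ
sumDiv n f = sum (map g (map suc (upTo n)))
  where
  g : ℕ → ℕ
  g zero    = 0
  g (suc k) = if does (suc k ∣? n) then f (suc k) else 0

boxVecs : (d b : ℕ) → List (Vec ℕ d)
boxVecs zero    b = [] ∷ []
boxVecs (suc d) b = concatMap (λ a → map (a ∷_) (boxVecs d b)) (upTo (suc b))

vsum : ∀ {d} → Vec ℕ d → ℕ
vsum = foldr _ _+_ 0

-- All α ∈ ℕ^d with α₁ + … + α_d = s  (each αᵢ ≤ s necessarily)
compositions : (d s : ℕ) → List (Vec ℕ d)
compositions d s = filter (λ α → vsum α ≟ s) (boxVecs d s)

binomProd : ∀ {d} → ℕ → Vec ℕ d → ℕ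
binomProd M α = foldr _ (λ a acc → (M C a) * acc) 1 α

alphaSum : (d M : ℕ) → ℤ → ℕ
alphaSum d M (+ s)    = sum (map (binomProd M) (compositions d s))
alphaSum d M -[1+ _ ] = 0

-- binom(a, b) for integer b, with binom(a, b) = 0 for b < 0 (and for b > a, as _C_ does)
binomℤ : ℕ → ℤ → ℕ
binomℤ a (+ b)    = a C b
binomℤ a -[1+ _ ] = 0

jRange : ℕ → List ℤ
jRange d = map (λ i → (+ i) ℤ.- (+ (d ∸ 1))) (upTo (2 * d ∸ 1))

theSum : (n M m₀ R r₀ : ℕ) → ℕ
theSum n M m₀ R r₀ = sumDiv n term
  where
  term : (d : ℕ) → .{{NonZero d}} → ℕ
  term d = φ (n / d) * sum (map (λ j → alphaSum d M ((+ (d * R)) ℤ.- j)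
                                        * binomℤ m₀ ((+ r₀) ℤ.+ (+ (n / d)) ℤ.* j))
                                (jRange d))

-- Words of length n over the alphabet of subsets of an M-set (a letter is its characteristic
-- vector in Bool^M, the weight of a word is the total size of its letters) are permuted by the
-- cyclic rotations. For a rotation-invariant f, the count Σ_{k<n} Σ_{rotate k w = w} f w equals
-- Σ_w f w · |Stab w|, and since |Stab w| · |orbit of w| = n, every orbit contributes a multiple
-- of n. Take f w = C(m₀, nR + r₀ − weight w). A word is fixed by rotation by k iff it repeats a
-- word of length d = gcd(k, n), each divisor d arises from φ(n/d) values of k, repeating
-- multiplies the weight by n/d, and the words of length d and weight s number
-- Σ_{α₁+⋯+α_d = s} ∏ C(M, αᵢ). Finally C(m₀, nR + r₀ − (n/d)s) = C(m₀, r₀ + (n/d)j) with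
-- j = dR − s, and this vanishes unless |j| < d.

module Submission where

open import Defs
open import Algebra.Properties.CommutativeSemigroup using (interchange)
open import Data.Bool using (Bool; true; false; if_then_else_)
import Data.Bool.Properties as Bool
open import Data.Fin using (Fin; toℕ; fromℕ<)
import Data.Fin as Fin
import Data.Fin.Properties as Fin
open import Data.Integer as ℤ using (ℤ; -[1+_])
import Data.Integer.Properties as ℤ
open import Data.Integer.Tactic.RingSolver using (solve-∀)
open import Data.List using (List; []; _∷_; map; upTo; applyUpTo; filter; concatMap; length; _++_)
open import Data.Nat using (ℕ; zero; suc; _+_; _*_; _∸_; _≤_; _<_; z≤n; s≤s; z<s; s≤s⁻¹; NonZero; ≢-nonZero; ≢-nonZero⁻¹; >-nonZero⁻¹)
open import Data.Nat.Combinatorics using (_C_; nCk+nC[k+1]≡[n+1]C[k+1])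
open import Data.Nat.Combinatorics.Specification using (k>n⇒nCk≡0)
open import Data.Nat.Divisibility using (_∣_; _∣?_; divides; ∣⇒≤; ∣m+n∣m⇒∣n; ∣m∣n⇒∣m+n; _∣0)
open import Data.Nat.DivMod
open import Data.Nat.GCD using (gcd; gcd-GCD; gcd[m,n]∣m; gcd[m,n]∣n; gcd[m,n]≢0; gcd[m,n]≤n; gcd-identityˡ; c*gcd[m,n]≡gcd[cm,cn]; module GCD; module Bézout)
open Bézout.Identity using (+-; -+)
open import Data.Nat.ListAction using (sum)
open import Data.Nat.Properties
import Data.Nat.Properties as ℕ
import Data.Nat.Tactic.RingSolver as ℕ-Solver
open import Data.Product using (∃; _×_; _,_; proj₁; proj₂)
open import Data.Sum using (inj₂)
open import Data.Vec using (Vec; []; _∷_; foldr; lookup; tabulate)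
import Data.Vec as Vec
import Data.Vec.Properties as Vec
open import Data.Vec.Relation.Unary.All as All using (All; []; _∷_)
open import Function using (_∘_; id)
open import Relation.Binary.Definitions using (DecidableEquality)
open import Relation.Binary.PropositionalEquality
open import Relation.Nullary using (Dec; yes; no; ¬_; contradiction)
open import Relation.Nullary.Decidable using (does; _×-dec_)

𝟙 : ∀ {p} {P : Set p} → Dec P → ℕ
𝟙 d = if does d then 1 else 0

𝟙-yes : ∀ {p} {P : Set p} (P? : Dec P) → P → 𝟙 P? ≡ 1
𝟙-yes (yes _) _ = refl
𝟙-yes (no ¬p) p = contradiction p ¬p

𝟙-no : ∀ {p} {P : Set p} (P? : Dec P) → ¬ P → 𝟙 P? ≡ 0
𝟙-no (yes p) ¬p = contradiction p ¬p
𝟙-no (no _) _ = refl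

𝟙-⇔ : ∀ {p q} {P : Set p} {Q : Set q} (P? : Dec P) (Q? : Dec Q) → (P → Q) → (Q → P) → 𝟙 P? ≡ 𝟙 Q?
𝟙-⇔ (yes p) Q? to from = sym (𝟙-yes Q? (to p))
𝟙-⇔ (no ¬p) Q? to from = sym (𝟙-no Q? (¬p ∘ from))

𝟙-pos : ∀ {p} {P : Set p} (P? : Dec P) → 0 < 𝟙 P? → P
𝟙-pos (yes p) _ = p

𝟙-×-dec : ∀ {p q} {P : Set p} {Q : Set q} (P? : Dec P) (Q? : Dec Q) → 𝟙 (P? ×-dec Q?) ≡ 𝟙 P? * 𝟙 Q?
𝟙-×-dec (yes _) Q? = sym (+-identityʳ (𝟙 Q?))
𝟙-×-dec (no _) Q? = refl

module _ {a} {A : Set a} (_≟_ : DecidableEquality A) where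

  𝟙-≡-sym : ∀ x y → 𝟙 (x ≟ y) ≡ 𝟙 (y ≟ x)
  𝟙-≡-sym x y = 𝟙-⇔ (x ≟ y) (y ≟ x) sym sym

  𝟙-≡-subst : ∀ x y (F : A → ℕ) → 𝟙 (x ≟ y) * F y ≡ 𝟙 (x ≟ y) * F x
  𝟙-≡-subst x y F with x ≟ y
  ... | yes refl = refl
  ... | no _ = refl

∑ : ∀ {a} {A : Set a} → List A → (A → ℕ) → ℕ
∑ xs f = sum (map f xs)

module _ {a} {A : Set a} where

  ∑-cong : (xs : List A) {f g : A → ℕ} → (∀ x → f x ≡ g x) → ∑ xs f ≡ ∑ xs g
  ∑-cong [] f≗g = refl
  ∑-cong (x ∷ xs) f≗g = cong₂ _+_ (f≗g x) (∑-cong xs f≗g)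

  ∑-++ : (xs ys : List A) (f : A → ℕ) → ∑ (xs ++ ys) f ≡ ∑ xs f + ∑ ys f
  ∑-++ [] ys f = refl
  ∑-++ (x ∷ xs) ys f = trans (cong (f x +_) (∑-++ xs ys f)) (sym (+-assoc (f x) _ _))

  ∑-+ : (xs : List A) (f g : A → ℕ) → ∑ xs (λ x → f x + g x) ≡ ∑ xs f + ∑ xs g
  ∑-+ [] f g = refl
  ∑-+ (x ∷ xs) f g = trans (cong (f x + g x +_) (∑-+ xs f g)) (interchange +-commutativeSemigroup (f x) (g x) _ _)

  ∑-*ˡ : (xs : List A) (c : ℕ) (f : A → ℕ) → ∑ xs (λ x → c * f x) ≡ c * ∑ xs f
  ∑-*ˡ [] c f = sym (*-zeroʳ c)
  ∑-*ˡ (x ∷ xs) c f = trans (cong (c * f x +_) (∑-*ˡ xs c f)) (sym (*-distribˡ-+ c (f x) _))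

  ∑-*ʳ : (xs : List A) (c : ℕ) (f : A → ℕ) → ∑ xs (λ x → f x * c) ≡ ∑ xs f * c
  ∑-*ʳ xs c f = trans (∑-cong xs (λ x → *-comm (f x) c)) (trans (∑-*ˡ xs c f) (*-comm c _))

  ∑-zero : (xs : List A) {f : A → ℕ} → (∀ x → f x ≡ 0) → ∑ xs f ≡ 0
  ∑-zero [] f≗0 = refl
  ∑-zero (x ∷ xs) f≗0 = cong₂ _+_ (f≗0 x) (∑-zero xs f≗0)

  ∑-pos : (xs : List A) (f : A → ℕ) → 0 < ∑ xs f → ∃ λ x → 0 < f x
  ∑-pos (x ∷ xs) f pos with f x in eq
  ... | zero = ∑-pos xs f pos
  ... | suc _ = x , subst (0 <_) (sym eq) (s≤s z≤n)

  ∑-filter : ∀ {p} {P : A → Set p} (P? : ∀ x → Dec (P x)) (xs : List A) (f : A → ℕ) →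
    ∑ (filter P? xs) f ≡ ∑ xs (λ x → 𝟙 (P? x) * f x)
  ∑-filter P? [] f = refl
  ∑-filter P? (x ∷ xs) f with P? x
  ... | yes _ = cong₂ _+_ (sym (+-identityʳ (f x))) (∑-filter P? xs f)
  ... | no _ = ∑-filter P? xs f

  length-filter : ∀ {p} {P : A → Set p} (P? : ∀ x → Dec (P x)) (xs : List A) →
    length (filter P? xs) ≡ ∑ xs (λ x → 𝟙 (P? x))
  length-filter P? [] = refl
  length-filter P? (x ∷ xs) with P? x
  ... | yes _ = cong suc (length-filter P? xs)
  ... | no _ = length-filter P? xs

module _ {a b} {A : Set a} {B : Set b} where

  ∑-map : (xs : List A) (g : A → B) (f : B → ℕ) → ∑ (map g xs) f ≡ ∑ xs (f ∘ g)
  ∑-map [] g f = refl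
  ∑-map (x ∷ xs) g f = cong (f (g x) +_) (∑-map xs g f)

  ∑-concatMap : (xs : List A) (g : A → List B) (f : B → ℕ) →
    ∑ (concatMap g xs) f ≡ ∑ xs (λ x → ∑ (g x) f)
  ∑-concatMap [] g f = refl
  ∑-concatMap (x ∷ xs) g f =
    trans (∑-++ (g x) (concatMap g xs) f) (cong (∑ (g x) f +_) (∑-concatMap xs g f))

  ∑-comm : (xs : List A) (ys : List B) (h : A → B → ℕ) →
    ∑ xs (λ x → ∑ ys (h x)) ≡ ∑ ys (λ y → ∑ xs (λ x → h x y))
  ∑-comm [] ys h = sym (∑-zero ys (λ _ → refl))
  ∑-comm (x ∷ xs) ys h =
    trans (cong (∑ ys (h x) +_) (∑-comm xs ys h)) (sym (∑-+ ys (h x) _))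

∑-pick : ∀ {a} {A : Set a} (_≟_ : DecidableEquality A) (xs : List A) {v : A} (f : A → ℕ) →
  (f v ≢ 0 → ∑ xs (λ x → 𝟙 (x ≟ v)) ≡ 1) → ∑ xs (λ x → 𝟙 (v ≟ x) * f x) ≡ f v
∑-pick _≟_ xs {v} f once = begin
  ∑ xs (λ x → 𝟙 (v ≟ x) * f x)   ≡⟨ ∑-cong xs (λ x → 𝟙-≡-subst _≟_ v x f) ⟩
  ∑ xs (λ x → 𝟙 (v ≟ x) * f v)   ≡⟨ ∑-*ʳ xs (f v) _ ⟩
  ∑ xs (λ x → 𝟙 (v ≟ x)) * f v   ≡⟨ cong (_* f v) (∑-cong xs (λ x → 𝟙-≡-sym _≟_ v x)) ⟩
  ∑ xs (λ x → 𝟙 (x ≟ v)) * f v   ≡⟨ count*f (f v ℕ.≟ 0) ⟩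
  f v                            ∎
  where
  open ≡-Reasoning
  count*f : Dec (f v ≡ 0) → ∑ xs (λ x → 𝟙 (x ≟ v)) * f v ≡ f v
  count*f (yes fv≡0) rewrite fv≡0 = *-zeroʳ (∑ xs (λ x → 𝟙 (x ≟ v)))
  count*f (no fv≢0) = trans (cong (_* f v) (once fv≢0)) (*-identityˡ (f v))

∑-fibres : ∀ {a b} {A : Set a} {B : Set b} (_≟_ : DecidableEquality B) (xs : List A) (ys : List B)
  (key : A → B) (F : B → ℕ) → (∀ x → F (key x) ≢ 0 → ∑ ys (λ y → 𝟙 (y ≟ key x)) ≡ 1) →
  ∑ xs (F ∘ key) ≡ ∑ ys (λ y → ∑ xs (λ x → 𝟙 (key x ≟ y)) * F y)
∑-fibres _≟_ xs ys key F once = begin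
  ∑ xs (F ∘ key)                                    ≡⟨ ∑-cong xs (λ x → sym (∑-pick _≟_ ys F (once x))) ⟩
  ∑ xs (λ x → ∑ ys (λ y → 𝟙 (key x ≟ y) * F y))     ≡⟨ ∑-comm xs ys _ ⟩
  ∑ ys (λ y → ∑ xs (λ x → 𝟙 (key x ≟ y) * F y))     ≡⟨ ∑-cong ys (λ y → ∑-*ʳ xs (F y) _) ⟩
  ∑ ys (λ y → ∑ xs (λ x → 𝟙 (key x ≟ y)) * F y)     ∎
  where open ≡-Reasoning

∑< : ℕ → (ℕ → ℕ) → ℕ
∑< zero f = 0
∑< (suc n) f = f 0 + ∑< n (f ∘ suc)

∑-applyUpTo : (n : ℕ) (g f : ℕ → ℕ) → ∑ (applyUpTo g n) f ≡ ∑< n (f ∘ g)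
∑-applyUpTo zero g f = refl
∑-applyUpTo (suc n) g f = cong (f (g 0) +_) (∑-applyUpTo n (g ∘ suc) f)

∑-upTo : (n : ℕ) (f : ℕ → ℕ) → ∑ (upTo n) f ≡ ∑< n f
∑-upTo n = ∑-applyUpTo n id

∑<-cong : (n : ℕ) {f g : ℕ → ℕ} → (∀ i → i < n → f i ≡ g i) → ∑< n f ≡ ∑< n g
∑<-cong zero f≗g = refl
∑<-cong (suc n) f≗g = cong₂ _+_ (f≗g 0 (s≤s z≤n)) (∑<-cong n (λ i i<n → f≗g (suc i) (s≤s i<n)))

∑<-zero : (n : ℕ) {f : ℕ → ℕ} → (∀ i → i < n → f i ≡ 0) → ∑< n f ≡ 0
∑<-zero zero f≗0 = refl
∑<-zero (suc n) f≗0 = cong₂ _+_ (f≗0 0 (s≤s z≤n)) (∑<-zero n (λ i i<n → f≗0 (suc i) (s≤s i<n)))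

∑<-const : (n c : ℕ) → ∑< n (λ _ → c) ≡ n * c
∑<-const zero c = refl
∑<-const (suc n) c = cong (c +_) (∑<-const n c)

∑<-split : (a b : ℕ) (f : ℕ → ℕ) → ∑< (a + b) f ≡ ∑< a f + ∑< b (λ i → f (a + i))
∑<-split zero b f = refl
∑<-split (suc a) b f = trans (cong (f 0 +_) (∑<-split a b (f ∘ suc))) (sym (+-assoc (f 0) _ _))

∑<-blocks : (m D : ℕ) (f : ℕ → ℕ) → ∑< (m * D) f ≡ ∑< m (λ i → ∑< D (λ t → f (i * D + t)))
∑<-blocks zero D f = refl
∑<-blocks (suc m) D f = trans (∑<-split D (m * D) f) (cong (∑< D f +_)
  (trans (∑<-blocks m D (λ j → f (D + j)))
         (∑<-cong m (λ i _ → ∑<-cong D (λ t _ → cong f (sym (+-assoc D (i * D) t)))))))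

∑<-repeat : (q g : ℕ) (f : ℕ → ℕ) → (∀ i → f (i + g) ≡ f i) → ∑< (q * g) f ≡ q * ∑< g f
∑<-repeat q g f periodic = begin
  ∑< (q * g) f                                ≡⟨ ∑<-blocks q g f ⟩
  ∑< q (λ i → ∑< g (λ t → f (i * g + t)))     ≡⟨ ∑<-cong q (λ i _ → ∑<-cong g (λ t _ → f[ig+t]≡f[t] i t)) ⟩
  ∑< q (λ _ → ∑< g f)                         ≡⟨ ∑<-const q (∑< g f) ⟩
  q * ∑< g f                                  ∎
  where
  open ≡-Reasoning
  f[ig+t]≡f[t] : ∀ i t → f (i * g + t) ≡ f t
  f[ig+t]≡f[t] zero t = refl
  f[ig+t]≡f[t] (suc i) t = begin
    f (g + i * g + t)   ≡⟨ cong f (trans (+-assoc g (i * g) t) (+-comm g (i * g + t))) ⟩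
    f (i * g + t + g)   ≡⟨ periodic (i * g + t) ⟩
    f (i * g + t)       ≡⟨ f[ig+t]≡f[t] i t ⟩
    f t                 ∎

∑<-*ˡ : (n c : ℕ) (f : ℕ → ℕ) → ∑< n (λ i → c * f i) ≡ c * ∑< n f
∑<-*ˡ n c f = trans (sym (∑-upTo n _)) (trans (∑-*ˡ (upTo n) c f) (cong (c *_) (∑-upTo n f)))

∑<-*ʳ : (n c : ℕ) (f : ℕ → ℕ) → ∑< n (λ i → f i * c) ≡ ∑< n f * c
∑<-*ʳ n c f = trans (sym (∑-upTo n _)) (trans (∑-*ʳ (upTo n) c f) (cong (_* c) (∑-upTo n f)))

∑<-comm-∑ : ∀ {a} {A : Set a} (n : ℕ) (xs : List A) (h : ℕ → A → ℕ) →
  ∑< n (λ i → ∑ xs (h i)) ≡ ∑ xs (λ x → ∑< n (λ i → h i x))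
∑<-comm-∑ n xs h = trans (sym (∑-upTo n _)) (trans (∑-comm (upTo n) xs h) (∑-cong xs (λ x → ∑-upTo n _)))

∑<-comm : (n m : ℕ) (h : ℕ → ℕ → ℕ) → ∑< n (λ i → ∑< m (h i)) ≡ ∑< m (λ j → ∑< n (λ i → h i j))
∑<-comm n m h = trans (∑<-cong n (λ i _ → sym (∑-upTo m (h i)))) (trans (∑<-comm-∑ n (upTo m) h) (∑-upTo m _))

∑<-pos : (n : ℕ) (f : ℕ → ℕ) → 0 < ∑< n f → ∃ λ i → 0 < f i
∑<-pos n f pos = ∑-pos (upTo n) f (subst (0 <_) (sym (∑-upTo n f)) pos)

∑<-𝟙-≡ : (n c : ℕ) → c < n → ∑< n (λ i → 𝟙 (i ≟ c)) ≡ 1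
∑<-𝟙-≡ (suc n) zero _ = cong suc (∑<-zero n (λ _ _ → refl))
∑<-𝟙-≡ (suc n) (suc c) (s≤s c<n) = ∑<-𝟙-≡ n c c<n

∑<-pick : (n c : ℕ) (f : ℕ → ℕ) → c < n → ∑< n (λ i → 𝟙 (c ≟ i) * f i) ≡ f c
∑<-pick n c f c<n = trans (sym (∑-upTo n _)) (∑-pick _≟_ (upTo n) f (λ _ → trans (∑-upTo n _) (∑<-𝟙-≡ n c c<n)))

∑<-last : (n : ℕ) (f : ℕ → ℕ) → ∑< (suc n) f ≡ ∑< n f + f n
∑<-last n f = begin
  ∑< (suc n) f                ≡⟨ cong (λ m → ∑< m f) (+-comm 1 n) ⟩
  ∑< (n + 1) f                ≡⟨ ∑<-split n 1 f ⟩
  ∑< n f + (f (n + 0) + 0)    ≡⟨ cong (λ t → ∑< n f + t) (trans (+-identityʳ _) (cong f (+-identityʳ n))) ⟩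
  ∑< n f + f n                ∎
  where open ≡-Reasoning

∑<-shift-one : (n : ℕ) (f : ℕ → ℕ) → f n ≡ f 0 → ∑< n (f ∘ suc) ≡ ∑< n f
∑<-shift-one n f fn≡f0 = +-cancelˡ-≡ (f 0) _ _ (begin
  ∑< (suc n) f   ≡⟨ ∑<-last n f ⟩
  ∑< n f + f n   ≡⟨ cong (∑< n f +_) fn≡f0 ⟩
  ∑< n f + f 0   ≡⟨ +-comm (∑< n f) (f 0) ⟩
  f 0 + ∑< n f   ∎)
  where open ≡-Reasoning

∑<-shift : (n : ℕ) (f : ℕ → ℕ) → (∀ i → f (i + n) ≡ f i) → (k : ℕ) → ∑< n (λ i → f (i + k)) ≡ ∑< n f
∑<-shift n f periodic zero = ∑<-cong n (λ i _ → cong f (+-identityʳ i))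
∑<-shift n f periodic (suc k) = begin
  ∑< n (λ i → f (i + suc k))     ≡⟨ ∑<-cong n (λ i _ → cong f (+-suc i k)) ⟩
  ∑< n (λ i → f (suc i + k))     ≡⟨ ∑<-shift-one n (λ i → f (i + k)) (trans (cong f (+-comm n k)) (periodic k)) ⟩
  ∑< n (λ i → f (i + k))         ≡⟨ ∑<-shift n f periodic k ⟩
  ∑< n f                         ∎
  where open ≡-Reasoning

IsEnumeration : ∀ {a} {A : Set a} → DecidableEquality A → List A → Set a
IsEnumeration _≟_ xs = ∀ y → ∑ xs (λ x → 𝟙 (x ≟ y)) ≡ 1

vectors : ∀ {a} {A : Set a} → List A → (g : ℕ) → List (Vec A g)
vectors xs zero = [] ∷ []
vectors xs (suc g) = concatMap (λ x → map (x ∷_) (vectors xs g)) xs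

∏ : ∀ {b} {B : Set b} {g} → (B → ℕ) → Vec B g → ℕ
∏ f = foldr _ (λ b acc → f b * acc) 1

∑-vectors-suc : ∀ {a} {A : Set a} (xs : List A) (g : ℕ) (f : Vec A (suc g) → ℕ) →
  ∑ (vectors xs (suc g)) f ≡ ∑ xs (λ x → ∑ (vectors xs g) (λ u → f (x ∷ u)))
∑-vectors-suc xs g f = trans (∑-concatMap xs _ f) (∑-cong xs (λ x → ∑-map (vectors xs g) (x ∷_) f))

module _ {a b} {A : Set a} {B : Set b} (_≟_ : DecidableEquality B) (h : A → B) (xs : List A) where

  ∑-vectors-fibre : ∀ {g} (β : Vec B g) →
    ∑ (vectors xs g) (λ v → 𝟙 (Vec.≡-dec _≟_ (Vec.map h v) β)) ≡ ∏ (λ b → ∑ xs (λ x → 𝟙 (h x ≟ b))) β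
  ∑-vectors-fibre [] = refl
  ∑-vectors-fibre {suc g} (b ∷ β) = begin
    ∑ (vectors xs (suc g)) (λ v → 𝟙 (Vec.≡-dec _≟_ (Vec.map h v) (b ∷ β)))
      ≡⟨ ∑-vectors-suc xs g _ ⟩
    ∑ xs (λ x → ∑ (vectors xs g) (λ u → 𝟙 (Vec.≡-dec _≟_ (h x ∷ Vec.map h u) (b ∷ β))))
      ≡⟨ ∑-cong xs (λ x → ∑-cong (vectors xs g) (λ u → 𝟙-×-dec (h x ≟ b) (Vec.≡-dec _≟_ (Vec.map h u) β))) ⟩
    ∑ xs (λ x → ∑ (vectors xs g) (λ u → 𝟙 (h x ≟ b) * fibre u))
      ≡⟨ ∑-cong xs (λ x → ∑-*ˡ (vectors xs g) (𝟙 (h x ≟ b)) fibre) ⟩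
    ∑ xs (λ x → 𝟙 (h x ≟ b) * ∑ (vectors xs g) fibre)
      ≡⟨ ∑-*ʳ xs _ _ ⟩
    ∑ xs (λ x → 𝟙 (h x ≟ b)) * ∑ (vectors xs g) fibre
      ≡⟨ cong (∑ xs (λ x → 𝟙 (h x ≟ b)) *_) (∑-vectors-fibre β) ⟩
    ∏ (λ b → ∑ xs (λ x → 𝟙 (h x ≟ b))) (b ∷ β) ∎
    where
    open ≡-Reasoning
    fibre : Vec A g → ℕ
    fibre u = 𝟙 (Vec.≡-dec _≟_ (Vec.map h u) β)

∏-≡1 : ∀ {b} {B : Set b} {g} (f : B → ℕ) {β : Vec B g} → All (λ b → f b ≡ 1) β → ∏ f β ≡ 1
∏-≡1 f [] = refl
∏-≡1 f (fb≡1 ∷ all) = cong₂ _*_ fb≡1 (∏-≡1 f all)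

∏-cong : ∀ {b} {B : Set b} {g} {f h : B → ℕ} → (∀ x → f x ≡ h x) → (β : Vec B g) → ∏ f β ≡ ∏ h β
∏-cong f≗h [] = refl
∏-cong f≗h (x ∷ β) = cong₂ _*_ (f≗h x) (∏-cong f≗h β)

vectors-count : ∀ {a} {A : Set a} (_≟_ : DecidableEquality A) (xs : List A) {g} {w : Vec A g} →
  All (λ b → ∑ xs (λ x → 𝟙 (x ≟ b)) ≡ 1) w → ∑ (vectors xs g) (λ v → 𝟙 (Vec.≡-dec _≟_ v w)) ≡ 1
vectors-count _≟_ xs {g} {w} once = begin
  ∑ (vectors xs g) (λ v → 𝟙 (Vec.≡-dec _≟_ v w))
    ≡⟨ ∑-cong (vectors xs g) (λ v → cong (λ u → 𝟙 (Vec.≡-dec _≟_ u w)) (sym (Vec.map-id v))) ⟩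
  ∑ (vectors xs g) (λ v → 𝟙 (Vec.≡-dec _≟_ (Vec.map id v) w))
    ≡⟨ ∑-vectors-fibre _≟_ id xs w ⟩
  ∏ (λ b → ∑ xs (λ x → 𝟙 (x ≟ b))) w
    ≡⟨ ∏-≡1 _ once ⟩
  1 ∎
  where open ≡-Reasoning

vectors-enumeration : ∀ {a} {A : Set a} (_≟_ : DecidableEquality A) (xs : List A) →
  IsEnumeration _≟_ xs → ∀ g → IsEnumeration (Vec.≡-dec _≟_) (vectors xs g)
vectors-enumeration _≟_ xs enum g w = vectors-count _≟_ xs (All.universal enum w)

subsets : (M : ℕ) → List (Vec Bool M)
subsets = vectors (false ∷ true ∷ [])

size : ∀ {M} → Vec Bool M → ℕ
size = foldr _ (λ b k → (if b then 1 else 0) + k) 0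

subsets-enumeration : ∀ M → IsEnumeration (Vec.≡-dec Bool._≟_) (subsets M)
subsets-enumeration = vectors-enumeration Bool._≟_ (false ∷ true ∷ []) λ { false → refl ; true → refl }

count-subsets-of-size : ∀ M a → ∑ (subsets M) (λ x → 𝟙 (size x ≟ a)) ≡ M C a
count-subsets-of-size zero zero = refl
count-subsets-of-size zero (suc a) = refl
count-subsets-of-size (suc M) a = begin
  ∑ (subsets (suc M)) (λ x → 𝟙 (size x ≟ a))
    ≡⟨ ∑-vectors-suc _ M _ ⟩
  ∑ (subsets M) (λ u → 𝟙 (size u ≟ a)) + (∑ (subsets M) (λ u → 𝟙 (suc (size u) ≟ a)) + 0)
    ≡⟨ cong (∑ (subsets M) (λ u → 𝟙 (size u ≟ a)) +_) (+-identityʳ _) ⟩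
  ∑ (subsets M) (λ u → 𝟙 (size u ≟ a)) + ∑ (subsets M) (λ u → 𝟙 (suc (size u) ≟ a))
    ≡⟨ pascal a ⟩
  suc M C a ∎
  where
  open ≡-Reasoning
  pascal : ∀ a → ∑ (subsets M) (λ u → 𝟙 (size u ≟ a)) + ∑ (subsets M) (λ u → 𝟙 (suc (size u) ≟ a)) ≡ suc M C a
  pascal zero = cong₂ _+_ (count-subsets-of-size M 0) (∑-zero (subsets M) (λ _ → refl))
  pascal (suc a) = begin
    ∑ (subsets M) (λ u → 𝟙 (size u ≟ suc a)) + ∑ (subsets M) (λ u → 𝟙 (size u ≟ a))
      ≡⟨ cong₂ _+_ (count-subsets-of-size M (suc a)) (count-subsets-of-size M a) ⟩
    M C suc a + M C a      ≡⟨ +-comm (M C suc a) (M C a) ⟩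
    M C a + M C suc a      ≡⟨ nCk+nC[k+1]≡[n+1]C[k+1] M a ⟩
    suc M C suc a          ∎

-- Cyclic words

module _ {a} {A : Set a} {n : ℕ} .{{_ : NonZero n}} where

  at : Vec A n → ℕ → A
  at w i = lookup w (fromℕ< (m%n<n i n))

  at-cong-mod : (w : Vec A n) {i j : ℕ} → i % n ≡ j % n → at w i ≡ at w j
  at-cong-mod w i≡j = cong (lookup w) (Fin.toℕ-injective
    (trans (Fin.toℕ-fromℕ< _) (trans i≡j (sym (Fin.toℕ-fromℕ< _)))))

  at-toℕ : (w : Vec A n) (j : Fin n) → at w (toℕ j) ≡ lookup w j
  at-toℕ w j = cong (lookup w) (Fin.toℕ-injective (trans (Fin.toℕ-fromℕ< _) (m<n⇒m%n≡m (Fin.toℕ<n j))))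

  at-+n : (w : Vec A n) (i : ℕ) → at w (i + n) ≡ at w i
  at-+n w i = at-cong-mod w ([m+n]%n≡m%n i n)

  at-+kn : (w : Vec A n) (i k : ℕ) → at w (i + k * n) ≡ at w i
  at-+kn w i k = at-cong-mod w ([m+kn]%n≡m%n i k n)

  at-injective : (w v : Vec A n) → (∀ i → at w i ≡ at v i) → w ≡ v
  at-injective w v w≗v = begin
    w                            ≡⟨ Vec.tabulate∘lookup w ⟨
    tabulate (lookup w)          ≡⟨ Vec.tabulate-cong (λ j → trans (sym (at-toℕ w j)) (trans (w≗v (toℕ j)) (at-toℕ v j))) ⟩
    tabulate (lookup v)          ≡⟨ Vec.tabulate∘lookup v ⟩
    v                            ∎
    where open ≡-Reasoning

  at-tabulate : (f : ℕ → A) (i : ℕ) → at (tabulate {n = n} (f ∘ toℕ)) i ≡ f (i % n)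
  at-tabulate f i = trans (Vec.lookup∘tabulate (f ∘ toℕ) (fromℕ< (m%n<n i n))) (cong f (Fin.toℕ-fromℕ< _))

  rotate : ℕ → Vec A n → Vec A n
  rotate k w = tabulate (λ j → at w (toℕ j + k))

  at-rotate : (k : ℕ) (w : Vec A n) (i : ℕ) → at (rotate k w) i ≡ at w (i + k)
  at-rotate k w i = trans (at-tabulate (λ j → at w (j + k)) i) (at-cong-mod w (begin
    (i % n + k) % n              ≡⟨ %-distribˡ-+ (i % n) k n ⟩
    (i % n % n + k % n) % n      ≡⟨ cong (λ t → (t + k % n) % n) (m%n%n≡m%n i n) ⟩
    (i % n + k % n) % n          ≡⟨ %-distribˡ-+ i k n ⟨
    (i + k) % n                  ∎))
    where open ≡-Reasoning

  rotate-rotate : (k l : ℕ) (w : Vec A n) → rotate k (rotate l w) ≡ rotate (k + l) w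
  rotate-rotate k l w = at-injective _ _ λ i → begin
    at (rotate k (rotate l w)) i  ≡⟨ at-rotate k (rotate l w) i ⟩
    at (rotate l w) (i + k)       ≡⟨ at-rotate l w (i + k) ⟩
    at w (i + k + l)              ≡⟨ cong (at w) (+-assoc i k l) ⟩
    at w (i + (k + l))            ≡⟨ at-rotate (k + l) w i ⟨
    at (rotate (k + l) w) i       ∎
    where open ≡-Reasoning

  rotate-+kn : (k c : ℕ) (w : Vec A n) → rotate (k + c * n) w ≡ rotate k w
  rotate-+kn k c w = at-injective _ _ λ i → begin
    at (rotate (k + c * n) w) i   ≡⟨ at-rotate (k + c * n) w i ⟩
    at w (i + (k + c * n))        ≡⟨ cong (at w) (+-assoc i k (c * n)) ⟨
    at w (i + k + c * n)          ≡⟨ at-+kn w (i + k) c ⟩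
    at w (i + k)                  ≡⟨ at-rotate k w i ⟨
    at (rotate k w) i             ∎
    where open ≡-Reasoning

  rotate-zero : (w : Vec A n) → rotate 0 w ≡ w
  rotate-zero w = at-injective _ _ λ i → trans (at-rotate 0 w i) (cong (at w) (+-identityʳ i))

  rotate-inverse : (k : ℕ) (w : Vec A n) → rotate k (rotate ((n ∸ 1) * k) w) ≡ w
  rotate-inverse k w = begin
    rotate k (rotate ((n ∸ 1) * k) w)  ≡⟨ rotate-rotate k _ w ⟩
    rotate (k + (n ∸ 1) * k) w         ≡⟨ cong (λ t → rotate t w) (k+[n-1]k≡k*n n) ⟩
    rotate (0 + k * n) w               ≡⟨ rotate-+kn 0 k w ⟩
    rotate 0 w                         ≡⟨ rotate-zero w ⟩
    w                                  ∎
    where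
    open ≡-Reasoning
    k+[n-1]k≡k*n : ∀ m .{{_ : NonZero m}} → k + (m ∸ 1) * k ≡ k * m
    k+[n-1]k≡k*n (suc m) = trans (cong (k +_) (*-comm m k)) (sym (*-suc k m))

  rotate-inverseˡ : (k : ℕ) (w : Vec A n) → rotate ((n ∸ 1) * k) (rotate k w) ≡ w
  rotate-inverseˡ k w = begin
    rotate t (rotate k w)   ≡⟨ rotate-rotate t k w ⟩
    rotate (t + k) w        ≡⟨ cong (λ s → rotate s w) (+-comm t k) ⟩
    rotate (k + t) w        ≡⟨ rotate-rotate k t w ⟨
    rotate k (rotate t w)   ≡⟨ rotate-inverse k w ⟩
    w                       ∎
    where
    open ≡-Reasoning
    t : ℕ
    t = (n ∸ 1) * k

-- Weighted Burnside lemma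

module Burnside {a} {A : Set a} (_≟_ : DecidableEquality A) (n : ℕ) .{{_ : NonZero n}}
  (U : List (Vec A n)) (enum : IsEnumeration (Vec.≡-dec _≟_) U) where

  _≟ᵥ_ : DecidableEquality (Vec A n)
  _≟ᵥ_ = Vec.≡-dec _≟_

  stabiliser : Vec A n → ℕ
  stabiliser w = ∑< n (λ k → 𝟙 (rotate k w ≟ᵥ w))

  transporters : Vec A n → Vec A n → ℕ
  transporters w₀ w = ∑< n (λ k → 𝟙 (rotate k w₀ ≟ᵥ w))

  Invariant : (Vec A n → ℕ) → Set a
  Invariant f = ∀ k w → f (rotate k w) ≡ f w

  𝟙-rotate-periodic : (w₀ w : Vec A n) (k : ℕ) → 𝟙 (rotate (k + n) w₀ ≟ᵥ w) ≡ 𝟙 (rotate k w₀ ≟ᵥ w)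
  𝟙-rotate-periodic w₀ w k = cong (λ v → 𝟙 (v ≟ᵥ w)) (trans (cong (λ s → rotate (k + s) w₀) (sym (*-identityˡ n))) (rotate-+kn k 1 w₀))

  stabiliser≡transporters : ∀ w₀ i → stabiliser (rotate i w₀) ≡ transporters w₀ (rotate i w₀)
  stabiliser≡transporters w₀ i = begin
    ∑< n (λ k → 𝟙 (rotate k (rotate i w₀) ≟ᵥ rotate i w₀))
      ≡⟨ ∑<-cong n (λ k _ → cong (λ v → 𝟙 (v ≟ᵥ rotate i w₀)) (rotate-rotate k i w₀)) ⟩
    ∑< n (λ k → 𝟙 (rotate (k + i) w₀ ≟ᵥ rotate i w₀))
      ≡⟨ ∑<-shift n _ (𝟙-rotate-periodic w₀ (rotate i w₀)) i ⟩
    transporters w₀ (rotate i w₀) ∎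
    where open ≡-Reasoning

  transporters-invariant : ∀ w₀ → Invariant (transporters w₀)
  transporters-invariant w₀ k w = begin
    ∑< n (λ i → 𝟙 (rotate i w₀ ≟ᵥ rotate k w))
      ≡⟨ ∑<-cong n (λ i _ → 𝟙-⇔ (rotate i w₀ ≟ᵥ rotate k w) (rotate (i + t) w₀ ≟ᵥ w) to from) ⟩
    ∑< n (λ i → 𝟙 (rotate (i + t) w₀ ≟ᵥ w))
      ≡⟨ ∑<-shift n _ (𝟙-rotate-periodic w₀ w) t ⟩
    transporters w₀ w ∎
    where
    open ≡-Reasoning
    t : ℕ
    t = (n ∸ 1) * k
    rotate-+t : ∀ i → rotate (i + t) w₀ ≡ rotate t (rotate i w₀)
    rotate-+t i = trans (cong (λ s → rotate s w₀) (+-comm i t)) (sym (rotate-rotate t i w₀))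
    to : ∀ {i} → rotate i w₀ ≡ rotate k w → rotate (i + t) w₀ ≡ w
    to {i} eq = trans (rotate-+t i) (trans (cong (rotate t) eq) (rotate-inverseˡ k w))
    from : ∀ {i} → rotate (i + t) w₀ ≡ w → rotate i w₀ ≡ rotate k w
    from {i} eq = trans (sym (rotate-inverse k (rotate i w₀))) (cong (rotate k) (trans (sym (rotate-+t i)) eq))

  transporters-pos : ∀ w₀ w → 0 < transporters w₀ w → ∃ λ i → rotate i w₀ ≡ w
  transporters-pos w₀ w pos with ∑<-pos n _ pos
  ... | i , 𝟙>0 = i , 𝟙-pos (rotate i w₀ ≟ᵥ w) 𝟙>0

  ∑-transporters : ∀ w₀ → ∑ U (transporters w₀) ≡ n
  ∑-transporters w₀ = begin
    ∑ U (λ w → ∑< n (λ k → 𝟙 (rotate k w₀ ≟ᵥ w)))   ≡⟨ ∑<-comm-∑ n U _ ⟨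
    ∑< n (λ k → ∑ U (λ w → 𝟙 (rotate k w₀ ≟ᵥ w)))
      ≡⟨ ∑<-cong n (λ k _ → trans (∑-cong U (λ w → 𝟙-≡-sym _≟ᵥ_ _ w)) (enum (rotate k w₀))) ⟩
    ∑< n (λ _ → 1)                                  ≡⟨ ∑<-const n 1 ⟩
    n * 1                                           ≡⟨ *-identityʳ n ⟩
    n                                               ∎
    where open ≡-Reasoning

  weighted : (Vec A n → ℕ) → ℕ
  weighted f = ∑ U (λ w → f w * stabiliser w)

  outsideOrbit : (Vec A n → ℕ) → Vec A n → Vec A n → ℕ
  outsideOrbit f w₀ w = f w * 𝟙 (transporters w₀ w ℕ.≟ 0)

  weighted-peel : ∀ f → Invariant f → ∀ w₀ → weighted f ≡ weighted (outsideOrbit f w₀) + f w₀ * n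
  weighted-peel f inv w₀ = begin
    weighted f                                                   ≡⟨ ∑-cong U split ⟩
    ∑ U (λ w → outsideOrbit f w₀ w * stabiliser w + f w₀ * transporters w₀ w)
                                                                 ≡⟨ ∑-+ U _ _ ⟩
    weighted (outsideOrbit f w₀) + ∑ U (λ w → f w₀ * transporters w₀ w)
                                                                 ≡⟨ cong (weighted (outsideOrbit f w₀) +_) (∑-*ˡ U (f w₀) _) ⟩
    weighted (outsideOrbit f w₀) + f w₀ * ∑ U (transporters w₀)  ≡⟨ cong (λ s → weighted (outsideOrbit f w₀) + f w₀ * s) (∑-transporters w₀) ⟩
    weighted (outsideOrbit f w₀) + f w₀ * n                      ∎
    where
    open ≡-Reasoning
    onOrbit : ∀ {w} → (∃ λ i → rotate i w₀ ≡ w) → f w * stabiliser w ≡ f w₀ * transporters w₀ w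
    onOrbit (i , refl) = cong₂ _*_ (inv i w₀) (stabiliser≡transporters w₀ i)
    split : ∀ w → f w * stabiliser w ≡ outsideOrbit f w₀ w * stabiliser w + f w₀ * transporters w₀ w
    split w = by-cases (transporters w₀ w ℕ.≟ 0)
      where
      by-cases : (t≟0 : Dec (transporters w₀ w ≡ 0)) →
        f w * stabiliser w ≡ f w * 𝟙 t≟0 * stabiliser w + f w₀ * transporters w₀ w
      by-cases (yes t≡0) rewrite t≡0 | *-identityʳ (f w) | *-zeroʳ (f w₀) = sym (+-identityʳ _)
      by-cases (no t≢0) rewrite *-zeroʳ (f w) = onOrbit (transporters-pos w₀ w (n≢0⇒n>0 t≢0))

  outsideOrbit-invariant : ∀ f → Invariant f → ∀ w₀ → Invariant (outsideOrbit f w₀)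
  outsideOrbit-invariant f inv w₀ k w =
    cong₂ (λ x t → x * 𝟙 (t ℕ.≟ 0)) (inv k w) (transporters-invariant w₀ k w)

  -- Induction on a bound for the weighted sum: each step removes one orbit, which contributes f w₀ · n.
  n∣weighted-≤ : ∀ b f → Invariant f → weighted f ≤ b → n ∣ weighted f
  n∣weighted-≤ b f inv w≤b with weighted f ℕ.≟ 0
  ... | yes w≡0 = subst (n ∣_) (sym w≡0) (n ∣0)
  n∣weighted-≤ zero f inv w≤0 | no w≢0 = contradiction (n≤0⇒n≡0 w≤0) w≢0
  n∣weighted-≤ (suc b) f inv w≤b | no w≢0 with ∑-pos U _ (n≢0⇒n>0 w≢0)
  ... | w₀ , fw₀*s>0 = subst (n ∣_) (sym (weighted-peel f inv w₀))
    (∣m∣n⇒∣m+n (n∣weighted-≤ b f′ (outsideOrbit-invariant f inv w₀) f′≤b) (divides (f w₀) refl))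
    where
    f′ : Vec A n → ℕ
    f′ = outsideOrbit f w₀
    1≤fw₀*n : 1 ≤ f w₀ * n
    1≤fw₀*n = *-mono-≤ (m*n>0⇒m>0 (f w₀) fw₀*s>0) (>-nonZero⁻¹ n)
      where
      m*n>0⇒m>0 : ∀ m {k} → 0 < m * k → 0 < m
      m*n>0⇒m>0 (suc _) _ = z<s
    f′≤b : weighted f′ ≤ b
    f′≤b = s≤s⁻¹ (begin
      suc (weighted f′)         ≡⟨ +-comm 1 _ ⟩
      weighted f′ + 1           ≤⟨ +-monoʳ-≤ (weighted f′) 1≤fw₀*n ⟩
      weighted f′ + f w₀ * n    ≡⟨ weighted-peel f inv w₀ ⟨
      weighted f                ≤⟨ w≤b ⟩
      suc b                     ∎)
      where open ≤-Reasoning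

  burnside : ∀ f → Invariant f → n ∣ ∑< n (λ k → ∑ U (λ w → 𝟙 (rotate k w ≟ᵥ w) * f w))
  burnside f inv = subst (n ∣_) (sym regroup) (n∣weighted-≤ (weighted f) f inv ≤-refl)
    where
    regroup : ∑< n (λ k → ∑ U (λ w → 𝟙 (rotate k w ≟ᵥ w) * f w)) ≡ weighted f
    regroup = trans (∑<-comm-∑ n U _) (∑-cong U (λ w →
      trans (∑<-cong n (λ k _ → *-comm (𝟙 (rotate k w ≟ᵥ w)) (f w))) (∑<-*ˡ n (f w) _)))

-- Words fixed by a rotation

module _ {a} {A : Set a} {n : ℕ} .{{_ : NonZero n}} where

  HasPeriod : ℕ → Vec A n → Set a
  HasPeriod p w = ∀ i → at w (i + p) ≡ at w i

  hasPeriod-* : ∀ {p} (w : Vec A n) → HasPeriod p w → ∀ c → HasPeriod (c * p) w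
  hasPeriod-* w per zero i = cong (at w) (+-identityʳ i)
  hasPeriod-* {p} w per (suc c) i = begin
    at w (i + (p + c * p))   ≡⟨ cong (at w) (+-assoc i p (c * p)) ⟨
    at w (i + p + c * p)     ≡⟨ hasPeriod-* w per c (i + p) ⟩
    at w (i + p)             ≡⟨ per i ⟩
    at w i                   ∎
    where open ≡-Reasoning

  hasPeriod-∣ : ∀ {p k} (w : Vec A n) → HasPeriod p w → p ∣ k → HasPeriod k w
  hasPeriod-∣ w per (divides c refl) = hasPeriod-* w per c

  hasPeriod-gcd : ∀ {k} (w : Vec A n) → HasPeriod k w → HasPeriod (gcd k n) w
  hasPeriod-gcd {k} w per i with Bézout.identity (gcd-GCD k n)
  ... | +- x y eq = begin
    at w (i + gcd k n)              ≡⟨ at-+kn w (i + gcd k n) y ⟨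
    at w (i + gcd k n + y * n)      ≡⟨ cong (at w) (trans (+-assoc i _ (y * n)) (cong (i +_) eq)) ⟩
    at w (i + x * k)                ≡⟨ hasPeriod-* w per x i ⟩
    at w i                          ∎
    where open ≡-Reasoning
  ... | -+ x y eq = begin
    at w (i + gcd k n)              ≡⟨ hasPeriod-* w per x (i + gcd k n) ⟨
    at w (i + gcd k n + x * k)      ≡⟨ cong (at w) (trans (+-assoc i _ (x * k)) (cong (i +_) eq)) ⟩
    at w (i + y * n)                ≡⟨ at-+kn w i y ⟩
    at w i                          ∎
    where open ≡-Reasoning

  rotate-fixed⇒hasPeriod : ∀ {k} {w : Vec A n} → rotate k w ≡ w → HasPeriod k w
  rotate-fixed⇒hasPeriod {k} {w} fixed i = trans (sym (at-rotate k w i)) (cong (λ v → at v i) fixed)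

  hasPeriod⇒rotate-fixed : ∀ {k} (w : Vec A n) → HasPeriod k w → rotate k w ≡ w
  hasPeriod⇒rotate-fixed {k} w per = at-injective _ _ (λ i → trans (at-rotate k w i) (per i))

module _ {a} {A : Set a} {n g : ℕ} .{{_ : NonZero n}} .{{_ : NonZero g}} (g∣n : g ∣ n) where

  repeat : Vec A g → Vec A n
  repeat u = tabulate (at u ∘ toℕ)

  prefix : Vec A n → Vec A g
  prefix w = tabulate (at w ∘ toℕ)

  at-repeat : ∀ u i → at (repeat u) i ≡ at u i
  at-repeat u i = trans (at-tabulate (at u) i) (at-cong-mod u (m∣n⇒o%n%m≡o%m g n i g∣n))

  repeat-hasPeriod : ∀ u → HasPeriod g (repeat u)
  repeat-hasPeriod u i = begin
    at (repeat u) (i + g)   ≡⟨ at-repeat u (i + g) ⟩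
    at u (i + g)            ≡⟨ at-+n u i ⟩
    at u i                  ≡⟨ at-repeat u i ⟨
    at (repeat u) i         ∎
    where open ≡-Reasoning

  prefix-repeat : ∀ u → prefix (repeat u) ≡ u
  prefix-repeat u = at-injective _ _ λ i → begin
    at (prefix (repeat u)) i   ≡⟨ at-tabulate (at (repeat u)) i ⟩
    at (repeat u) (i % g)      ≡⟨ at-repeat u (i % g) ⟩
    at u (i % g)               ≡⟨ at-cong-mod u (m%n%n≡m%n i g) ⟩
    at u i                     ∎
    where open ≡-Reasoning

  repeat-prefix : ∀ {w : Vec A n} → HasPeriod g w → repeat (prefix w) ≡ w
  repeat-prefix {w} per = at-injective _ _ λ i → begin
    at (repeat (prefix w)) i          ≡⟨ at-repeat (prefix w) i ⟩
    at (prefix w) i                   ≡⟨ at-tabulate (at w) i ⟩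
    at w (i % g)                      ≡⟨ hasPeriod-* w per (i / g) (i % g) ⟨
    at w (i % g + i / g * g)          ≡⟨ cong (at w) (m≡m%n+[m/n]*n i g) ⟨
    at w i                            ∎
    where open ≡-Reasoning

gcd-nonZero : ∀ k n .{{_ : NonZero n}} → NonZero (gcd k n)
gcd-nonZero k n = ≢-nonZero (gcd[m,n]≢0 k n (inj₂ (≢-nonZero⁻¹ n)))

module _ {a} {A : Set a} (_≟_ : DecidableEquality A) {xs : List A} (enum : IsEnumeration _≟_ xs)
         {n : ℕ} .{{_ : NonZero n}} (k : ℕ) where

  private
    _≟ᵥ_ : ∀ {m} → DecidableEquality (Vec A m)
    _≟ᵥ_ = Vec.≡-dec _≟_
    g : ℕ
    g = gcd k n
    g∣n : g ∣ n
    g∣n = gcd[m,n]∣n k n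
    instance
      g≢0 : NonZero g
      g≢0 = gcd-nonZero k n

  𝟙-rotate-fixed : ∀ w → 𝟙 (rotate k w ≟ᵥ w) ≡ ∑ (vectors xs g) (λ u → 𝟙 (repeat g∣n u ≟ᵥ w))
  𝟙-rotate-fixed w = by-cases (rotate k w ≟ᵥ w)
    where
    open ≡-Reasoning
    by-cases : (fixed? : Dec (rotate k w ≡ w)) → 𝟙 fixed? ≡ ∑ (vectors xs g) (λ u → 𝟙 (repeat g∣n u ≟ᵥ w))
    by-cases (yes fixed) = sym (begin
      ∑ (vectors xs g) (λ u → 𝟙 (repeat g∣n u ≟ᵥ w))
        ≡⟨ ∑-cong (vectors xs g) (λ u → 𝟙-⇔ (repeat g∣n u ≟ᵥ w) (u ≟ᵥ prefix g∣n w) to from) ⟩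
      ∑ (vectors xs g) (λ u → 𝟙 (u ≟ᵥ prefix g∣n w))
        ≡⟨ vectors-enumeration _≟_ xs enum g (prefix g∣n w) ⟩
      1 ∎)
      where
      to : ∀ {u} → repeat g∣n u ≡ w → u ≡ prefix g∣n w
      to {u} eq = trans (sym (prefix-repeat g∣n u)) (cong (prefix g∣n) eq)
      from : ∀ {u} → u ≡ prefix g∣n w → repeat g∣n u ≡ w
      from refl = repeat-prefix g∣n (hasPeriod-gcd w (rotate-fixed⇒hasPeriod fixed))
    by-cases (no ¬fixed) = sym (∑-zero (vectors xs g) λ u → 𝟙-no (repeat g∣n u ≟ᵥ w) (¬fixed ∘ repeat-fixed u))
      where
      repeat-fixed : ∀ u → repeat g∣n u ≡ w → rotate k w ≡ w
      repeat-fixed u eq = subst (λ v → rotate k v ≡ v) eq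
        (hasPeriod⇒rotate-fixed (repeat g∣n u) (hasPeriod-∣ (repeat g∣n u) (repeat-hasPeriod g∣n u) (gcd[m,n]∣m k n)))

  ∑-rotate-fixed : (F : Vec A n → ℕ) →
    ∑ (vectors xs n) (λ w → 𝟙 (rotate k w ≟ᵥ w) * F w) ≡ ∑ (vectors xs g) (F ∘ repeat g∣n)
  ∑-rotate-fixed F = begin
    ∑ (vectors xs n) (λ w → 𝟙 (rotate k w ≟ᵥ w) * F w)
      ≡⟨ ∑-cong (vectors xs n) (λ w → trans (cong (_* F w) (𝟙-rotate-fixed w)) (sym (∑-*ʳ (vectors xs g) (F w) _))) ⟩
    ∑ (vectors xs n) (λ w → ∑ (vectors xs g) (λ u → 𝟙 (repeat g∣n u ≟ᵥ w) * F w))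
      ≡⟨ ∑-comm (vectors xs n) (vectors xs g) _ ⟩
    ∑ (vectors xs g) (λ u → ∑ (vectors xs n) (λ w → 𝟙 (repeat g∣n u ≟ᵥ w) * F w))
      ≡⟨ ∑-cong (vectors xs g) (λ u → ∑-pick _≟ᵥ_ (vectors xs n) F (λ _ → vectors-enumeration _≟_ xs enum n (repeat g∣n u))) ⟩
    ∑ (vectors xs g) (F ∘ repeat g∣n) ∎
    where open ≡-Reasoning

-- Grouping rotations by their gcd with n

φ≡∑< : ∀ m → φ m ≡ ∑< m (λ i → 𝟙 (gcd (suc i) m ≟ 1))
φ≡∑< m = trans (length-filter (λ i → gcd i m ≟ 1) (map suc (upTo m)))
               (trans (∑-map (upTo m) suc _) (∑-upTo m _))

sumDiv≡∑< : ∀ n (f : (d : ℕ) → .{{_ : NonZero d}} → ℕ) →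
  sumDiv n f ≡ ∑< n (λ i → if does (suc i ∣? n) then f (suc i) else 0)
sumDiv≡∑< n f = trans (∑-map (upTo n) suc _) (∑-upTo n _)

gcd[m,m]≡m : ∀ m → gcd m m ≡ m
gcd[m,m]≡m m = GCD.unique (gcd-GCD m m) GCD.refl

count-gcd[k,mD]≡D : ∀ m D .{{_ : NonZero D}} → ∑< (m * D) (λ k → 𝟙 (gcd k (m * D) ≟ D)) ≡ φ m
count-gcd[k,mD]≡D m D@(suc d) = begin
  ∑< (m * D) (λ k → 𝟙 (gcd k (m * D) ≟ D))
    ≡⟨ ∑<-blocks m D _ ⟩
  ∑< m (λ i → 𝟙 (gcd (i * D + 0) (m * D) ≟ D) + ∑< d (λ t → 𝟙 (gcd (i * D + suc t) (m * D) ≟ D)))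
    ≡⟨ ∑<-cong m (λ i _ → cong₂ _+_ (cong (λ x → 𝟙 (gcd x (m * D) ≟ D)) (+-identityʳ (i * D)))
                                   (∑<-zero d (λ t t<d → 𝟙-no (_ ≟ D) (off-multiple i t t<d)))) ⟩
  ∑< m (λ i → 𝟙 (gcd (i * D) (m * D) ≟ D) + 0)
    ≡⟨ ∑<-cong m (λ i _ → trans (+-identityʳ _) (𝟙-⇔ (gcd (i * D) (m * D) ≟ D) (gcd i m ≟ 1) (coprime-to i) (coprime-from i))) ⟩
  ∑< m (λ i → 𝟙 (gcd i m ≟ 1))
    ≡⟨ ∑<-shift-one m (λ i → 𝟙 (gcd i m ≟ 1)) (cong (λ x → 𝟙 (x ≟ 1)) (trans (gcd[m,m]≡m m) (sym (gcd-identityˡ m)))) ⟨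
  ∑< m (λ i → 𝟙 (gcd (suc i) m ≟ 1))
    ≡⟨ φ≡∑< m ⟨
  φ m ∎
  where
  open ≡-Reasoning
  off-multiple : ∀ i t → t < d → gcd (i * D + suc t) (m * D) ≢ D
  off-multiple i t t<d gcd≡D = <⇒≱ t<d (s≤s⁻¹ (∣⇒≤ (∣m+n∣m⇒∣n D∣iD+1+t (divides i refl))))
    where
    D∣iD+1+t : D ∣ i * D + suc t
    D∣iD+1+t = subst (_∣ i * D + suc t) gcd≡D (gcd[m,n]∣m _ _)
  gcd[iD,mD]≡D*gcd[i,m] : ∀ i → gcd (i * D) (m * D) ≡ D * gcd i m
  gcd[iD,mD]≡D*gcd[i,m] i = trans (cong₂ gcd (*-comm i D) (*-comm m D)) (sym (c*gcd[m,n]≡gcd[cm,cn] D i m))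
  coprime-to : ∀ i → gcd (i * D) (m * D) ≡ D → gcd i m ≡ 1
  coprime-to i eq = *-cancelˡ-≡ (gcd i m) 1 D (trans (sym (gcd[iD,mD]≡D*gcd[i,m] i)) (trans eq (sym (*-identityʳ D))))
  coprime-from : ∀ i → gcd i m ≡ 1 → gcd (i * D) (m * D) ≡ D
  coprime-from i eq = trans (gcd[iD,mD]≡D*gcd[i,m] i) (trans (cong (D *_) eq) (*-identityʳ D))

count-gcd[k,n]≡d : ∀ n .{{_ : NonZero n}} d .{{_ : NonZero d}} →
  ∑< n (λ k → 𝟙 (gcd k n ≟ d)) ≡ (if does (d ∣? n) then φ (n / d) else 0)
count-gcd[k,n]≡d n d = by-cases (d ∣? n)
  where
  by-cases : (d∣?n : Dec (d ∣ n)) → ∑< n (λ k → 𝟙 (gcd k n ≟ d)) ≡ (if does d∣?n then φ (n / d) else 0)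
  by-cases (yes d∣n) = subst (λ x → ∑< x (λ k → 𝟙 (gcd k x ≟ d)) ≡ φ (n / d)) (m/n*n≡m d∣n) (count-gcd[k,mD]≡D (n / d) d)
  by-cases (no d∤n) = ∑<-zero n (λ k _ → 𝟙-no (gcd k n ≟ d) (λ gcd≡d → d∤n (subst (_∣ n) gcd≡d (gcd[m,n]∣n k n))))

∑<-gcd≡sumDiv : ∀ n .{{_ : NonZero n}} (h : (d : ℕ) → .{{_ : NonZero d}} → ℕ) →
  ∑< n (λ k → h (gcd k n) {{gcd-nonZero k n}}) ≡ sumDiv n (λ d → φ (n / d) * h d)
∑<-gcd≡sumDiv n h = begin
  ∑< n (λ k → h (gcd k n) {{gcd-nonZero k n}})
    ≡⟨ ∑<-cong n (λ k _ → expand (gcd k n) {{gcd-nonZero k n}} (gcd[m,n]≤n k n)) ⟩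
  ∑< n (λ k → ∑< n (λ i → 𝟙 (gcd k n ≟ suc i) * h (suc i)))
    ≡⟨ ∑<-comm n n _ ⟩
  ∑< n (λ i → ∑< n (λ k → 𝟙 (gcd k n ≟ suc i) * h (suc i)))
    ≡⟨ ∑<-cong n (λ i _ → ∑<-*ʳ n (h (suc i)) _) ⟩
  ∑< n (λ i → ∑< n (λ k → 𝟙 (gcd k n ≟ suc i)) * h (suc i))
    ≡⟨ ∑<-cong n (λ i _ → cong (_* h (suc i)) (count-gcd[k,n]≡d n (suc i))) ⟩
  ∑< n (λ i → (if does (suc i ∣? n) then φ (n / suc i) else 0) * h (suc i))
    ≡⟨ ∑<-cong n (λ i _ → if-*ʳ (does (suc i ∣? n))) ⟩
  ∑< n (λ i → if does (suc i ∣? n) then φ (n / suc i) * h (suc i) else 0)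
    ≡⟨ sumDiv≡∑< n (λ d → φ (n / d) * h d) ⟨
  sumDiv n (λ d → φ (n / d) * h d) ∎
  where
  open ≡-Reasoning
  expand : ∀ g .{{_ : NonZero g}} → g ≤ n → h g ≡ ∑< n (λ i → 𝟙 (g ≟ suc i) * h (suc i))
  expand (suc x) 1+x≤n = sym (∑<-pick n x (λ i → h (suc i)) 1+x≤n)
  if-*ʳ : ∀ {x y} b → (if b then x else 0) * y ≡ (if b then x * y else 0)
  if-*ʳ true = refl
  if-*ʳ false = refl

sumDiv-cong : ∀ n {f g : (d : ℕ) → .{{_ : NonZero d}} → ℕ} → (∀ d .{{_ : NonZero d}} → d ∣ n → f d ≡ g d) →
  sumDiv n f ≡ sumDiv n g
sumDiv-cong n {f} {g} f≗g = trans (sumDiv≡∑< n f) (trans (∑<-cong n (λ i _ → by-cases i (suc i ∣? n))) (sym (sumDiv≡∑< n g)))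
  where
  by-cases : ∀ i (d∣?n : Dec (suc i ∣ n)) → (if does d∣?n then f (suc i) else 0) ≡ (if does d∣?n then g (suc i) else 0)
  by-cases i (yes d∣n) = f≗g (suc i) d∣n
  by-cases i (no _) = refl

-- Weights and compositions

module _ {a} {A : Set a} (wt : A → ℕ) where

  weight : ∀ {m} → Vec A m → ℕ
  weight u = vsum (Vec.map wt u)

  ∑<-lookup≡weight : ∀ {m} (u : Vec A m) (f : ℕ → ℕ) → (∀ j → f (toℕ j) ≡ wt (lookup u j)) → ∑< m f ≡ weight u
  ∑<-lookup≡weight [] f f≗ = refl
  ∑<-lookup≡weight (x ∷ u) f f≗ = cong₂ _+_ (f≗ Fin.zero) (∑<-lookup≡weight u (f ∘ suc) (f≗ ∘ Fin.suc))

  ∑<-at≡weight : ∀ {m} .{{_ : NonZero m}} (u : Vec A m) → ∑< m (wt ∘ at u) ≡ weight u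
  ∑<-at≡weight u = ∑<-lookup≡weight u _ (λ j → cong wt (at-toℕ u j))

  weight-rotate : ∀ {m} .{{_ : NonZero m}} (k : ℕ) (w : Vec A m) → weight (rotate k w) ≡ weight w
  weight-rotate {m} k w = begin
    weight (rotate k w)             ≡⟨ ∑<-at≡weight (rotate k w) ⟨
    ∑< m (wt ∘ at (rotate k w))     ≡⟨ ∑<-cong m (λ i _ → cong wt (at-rotate k w i)) ⟩
    ∑< m (λ i → wt (at w (i + k)))  ≡⟨ ∑<-shift m (wt ∘ at w) (cong wt ∘ at-+n w) k ⟩
    ∑< m (wt ∘ at w)                ≡⟨ ∑<-at≡weight w ⟩
    weight w                        ∎
    where open ≡-Reasoning

  weight-repeat : ∀ {n g} .{{_ : NonZero n}} .{{_ : NonZero g}} (g∣n : g ∣ n) (u : Vec A g) →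
    weight (repeat g∣n u) ≡ n / g * weight u
  weight-repeat {n} {g} g∣n u = begin
    weight (repeat g∣n u)               ≡⟨ ∑<-at≡weight (repeat g∣n u) ⟨
    ∑< n (wt ∘ at (repeat g∣n u))       ≡⟨ ∑<-cong n (λ i _ → cong wt (at-repeat g∣n u i)) ⟩
    ∑< n (wt ∘ at u)                    ≡⟨ cong (λ t → ∑< t (wt ∘ at u)) (m/n*n≡m g∣n) ⟨
    ∑< (n / g * g) (wt ∘ at u)          ≡⟨ ∑<-repeat (n / g) g (wt ∘ at u) (cong wt ∘ at-+n u) ⟩
    n / g * ∑< g (wt ∘ at u)            ≡⟨ cong (n / g *_) (∑<-at≡weight u) ⟩
    n / g * weight u                    ∎
    where open ≡-Reasoning

boxVecs≡vectors : ∀ D s → boxVecs D s ≡ vectors (upTo (suc s)) D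
boxVecs≡vectors zero s = refl
boxVecs≡vectors (suc D) s = cong (λ αs → concatMap (λ a → map (a ∷_) αs) (upTo (suc s))) (boxVecs≡vectors D s)

vsum≤⇒All≤ : ∀ {D s} (α : Vec ℕ D) → vsum α ≤ s → All (_≤ s) α
vsum≤⇒All≤ [] _ = []
vsum≤⇒All≤ (a ∷ α) a+α≤s = ≤-trans (m≤m+n a (vsum α)) a+α≤s ∷ vsum≤⇒All≤ α (≤-trans (m≤n+m (vsum α) a) a+α≤s)

_≟ℕᵥ_ : ∀ {D} → DecidableEquality (Vec ℕ D)
_≟ℕᵥ_ = Vec.≡-dec _≟_

boxVecs-count : ∀ {D s} (α : Vec ℕ D) → vsum α ≤ s → ∑ (boxVecs D s) (λ β → 𝟙 (β ≟ℕᵥ α)) ≡ 1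
boxVecs-count {D} {s} α α≤s = begin
  ∑ (boxVecs D s) (λ β → 𝟙 (β ≟ℕᵥ α))             ≡⟨ cong (λ βs → ∑ βs (λ β → 𝟙 (β ≟ℕᵥ α))) (boxVecs≡vectors D s) ⟩
  ∑ (vectors (upTo (suc s)) D) (λ β → 𝟙 (β ≟ℕᵥ α)) ≡⟨ vectors-count _≟_ (upTo (suc s)) (All.map once (vsum≤⇒All≤ α α≤s)) ⟩
  1                                             ∎
  where
  open ≡-Reasoning
  once : ∀ {a} → a ≤ s → ∑ (upTo (suc s)) (λ x → 𝟙 (x ≟ a)) ≡ 1
  once {a} a≤s = trans (∑-upTo (suc s) _) (∑<-𝟙-≡ (suc s) a (s≤s a≤s))

binomProd≡count : ∀ M {D} (α : Vec ℕ D) → binomProd M α ≡ ∑ (vectors (subsets M) D) (λ u → 𝟙 (Vec.map size u ≟ℕᵥ α))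
binomProd≡count M α = sym (trans (∑-vectors-fibre _≟_ size (subsets M) α) (∏-cong (count-subsets-of-size M) α))

open import Data.Integer using (+_)

x-[x-y]≡y : ∀ (x y : ℤ) → x ℤ.- (x ℤ.- y) ≡ y
x-[x-y]≡y = solve-∀

private
  x≡x-y+y : ∀ (x y : ℤ) → x ≡ (x ℤ.- y) ℤ.+ y
  x≡x-y+y = solve-∀

  x-y≡[x+z]-[y+z] : ∀ (x y z : ℤ) → x ℤ.- y ≡ (x ℤ.+ z) ℤ.- (y ℤ.+ z)
  x-y≡[x+z]-[y+z] = solve-∀

  [x+y]-[y+z]≡x-z : ∀ (x y z : ℤ) → (x ℤ.+ y) ℤ.- (y ℤ.+ z) ≡ x ℤ.- z
  [x+y]-[y+z]≡x-z = solve-∀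

  [r+q[a-s]]+qs≡qa+r : ∀ (r q a s : ℤ) → (r ℤ.+ q ℤ.* (a ℤ.- s)) ℤ.+ q ℤ.* s ≡ q ℤ.* a ℤ.+ r
  [r+q[a-s]]+qs≡qa+r = solve-∀

  [qa+r]-qs≡r+q[a-s] : ∀ (q a r s : ℤ) → (q ℤ.* a ℤ.+ r) ℤ.- q ℤ.* s ≡ r ℤ.+ q ℤ.* (a ℤ.- s)
  [qa+r]-qs≡r+q[a-s] = solve-∀

a-x≡j⇒x≡a-j : ∀ {a x j : ℤ} → a ℤ.- x ≡ j → x ≡ a ℤ.- j
a-x≡j⇒x≡a-j {a} {x} eq = trans (sym (x-[x-y]≡y a x)) (cong (λ t → a ℤ.- t) eq)

x-z≡y-z⇒x≡y : ∀ {x y z : ℤ} → x ℤ.- z ≡ y ℤ.- z → x ≡ y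
x-z≡y-z⇒x≡y {x} {y} {z} eq = trans (x≡x-y+y x z) (trans (cong (λ t → t ℤ.+ z) eq) (sym (x≡x-y+y y z)))

[+a]-[+b]≡[+c]-[+d] : ∀ a b c d → a + d ≡ c + b → + a ℤ.- + b ≡ + c ℤ.- + d
[+a]-[+b]≡[+c]-[+d] a b c d a+d≡c+b = begin
  + a ℤ.- + b                             ≡⟨ x-y≡[x+z]-[y+z] (+ a) (+ b) (+ d) ⟩
  (+ a ℤ.+ + d) ℤ.- (+ b ℤ.+ + d)         ≡⟨ cong (λ t → t ℤ.- (+ b ℤ.+ + d)) (trans (sym (ℤ.pos-+ a d)) (trans (cong +_ a+d≡c+b) (ℤ.pos-+ c b))) ⟩
  (+ c ℤ.+ + b) ℤ.- (+ b ℤ.+ + d)         ≡⟨ [x+y]-[y+z]≡x-z (+ c) (+ b) (+ d) ⟩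
  + c ℤ.- + d                             ∎
  where open ≡-Reasoning

[+[qa+r]]-[+qs]≡+r+q[a-s] : ∀ q a r s → + (q * a + r) ℤ.- + (q * s) ≡ + r ℤ.+ + q ℤ.* (+ a ℤ.- + s)
[+[qa+r]]-[+qs]≡+r+q[a-s] q a r s = begin
  + (q * a + r) ℤ.- + (q * s)                 ≡⟨ cong₂ ℤ._-_ (trans (ℤ.pos-+ (q * a) r) (cong (λ t → t ℤ.+ + r) (ℤ.pos-* q a))) (ℤ.pos-* q s) ⟩
  (+ q ℤ.* + a ℤ.+ + r) ℤ.- + q ℤ.* + s       ≡⟨ [qa+r]-qs≡r+q[a-s] (+ q) (+ a) (+ r) (+ s) ⟩
  + r ℤ.+ + q ℤ.* (+ a ℤ.- + s)               ∎
  where open ≡-Reasoning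

+r+q[a-s]≡+b⇒b+qs≡qa+r : ∀ {q a r s b} → + r ℤ.+ + q ℤ.* (+ a ℤ.- + s) ≡ + b → b + q * s ≡ q * a + r
+r+q[a-s]≡+b⇒b+qs≡qa+r {q} {a} {r} {s} {b} eq = ℤ.+-injective (begin
  + (b + q * s)                                        ≡⟨ trans (ℤ.pos-+ b (q * s)) (cong (λ t → + b ℤ.+ t) (ℤ.pos-* q s)) ⟩
  + b ℤ.+ + q ℤ.* + s                                  ≡⟨ cong (λ t → t ℤ.+ + q ℤ.* + s) eq ⟨
  (+ r ℤ.+ + q ℤ.* (+ a ℤ.- + s)) ℤ.+ + q ℤ.* + s      ≡⟨ [r+q[a-s]]+qs≡qa+r (+ r) (+ q) (+ a) (+ s) ⟩
  + q ℤ.* + a ℤ.+ + r                                  ≡⟨ trans (ℤ.pos-+ (q * a) r) (cong (λ t → t ℤ.+ + r) (ℤ.pos-* q a)) ⟨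
  + (q * a + r)                                        ∎)
  where open ≡-Reasoning

count-weight≡alphaSum : ∀ M D s → ∑ (vectors (subsets M) D) (λ u → 𝟙 (weight size u ≟ s)) ≡ alphaSum D M (+ s)
count-weight≡alphaSum M D s = sym (begin
  ∑ (compositions D s) (binomProd M)
    ≡⟨ ∑-filter (λ α → vsum α ≟ s) (boxVecs D s) (binomProd M) ⟩
  ∑ (boxVecs D s) (λ α → 𝟙 (vsum α ≟ s) * binomProd M α)
    ≡⟨ ∑-cong (boxVecs D s) (λ α → cong (𝟙 (vsum α ≟ s) *_) (binomProd≡count M α)) ⟩
  ∑ (boxVecs D s) (λ α → 𝟙 (vsum α ≟ s) * ∑ U (λ u → 𝟙 (Vec.map size u ≟ℕᵥ α)))
    ≡⟨ ∑-cong (boxVecs D s) (λ α → sym (∑-*ˡ U (𝟙 (vsum α ≟ s)) _)) ⟩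
  ∑ (boxVecs D s) (λ α → ∑ U (λ u → 𝟙 (vsum α ≟ s) * 𝟙 (Vec.map size u ≟ℕᵥ α)))
    ≡⟨ ∑-comm (boxVecs D s) U _ ⟩
  ∑ U (λ u → ∑ (boxVecs D s) (λ α → 𝟙 (vsum α ≟ s) * 𝟙 (Vec.map size u ≟ℕᵥ α)))
    ≡⟨ ∑-cong U (λ u → ∑-cong (boxVecs D s) (λ α → *-comm (𝟙 (vsum α ≟ s)) _)) ⟩
  ∑ U (λ u → ∑ (boxVecs D s) (λ α → 𝟙 (Vec.map size u ≟ℕᵥ α) * 𝟙 (vsum α ≟ s)))
    ≡⟨ ∑-cong U (λ u → ∑-pick _≟ℕᵥ_ (boxVecs D s) (λ α → 𝟙 (vsum α ≟ s)) (in-box (Vec.map size u))) ⟩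
  ∑ U (λ u → 𝟙 (weight size u ≟ s)) ∎)
  where
  open ≡-Reasoning
  U : List (Vec (Vec Bool M) D)
  U = vectors (subsets M) D
  in-box : ∀ α → 𝟙 (vsum α ≟ s) ≢ 0 → ∑ (boxVecs D s) (λ β → 𝟙 (β ≟ℕᵥ α)) ≡ 1
  in-box α 𝟙≢0 = boxVecs-count α (≤-reflexive (𝟙-pos (vsum α ≟ s) (n≢0⇒n>0 𝟙≢0)))

count-key≡alphaSum : ∀ M D (a j : ℤ) →
  ∑ (vectors (subsets M) D) (λ u → 𝟙 (a ℤ.- + weight size u ℤ.≟ j)) ≡ alphaSum D M (a ℤ.- j)
count-key≡alphaSum M D a j = by-cases (a ℤ.- j) refl
  where
  U : List (Vec (Vec Bool M) D)
  U = vectors (subsets M) D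
  by-cases : ∀ z → a ℤ.- j ≡ z → ∑ U (λ u → 𝟙 (a ℤ.- + weight size u ℤ.≟ j)) ≡ alphaSum D M z
  by-cases (+ s) a-j≡s = trans
    (∑-cong U (λ u → 𝟙-⇔ (a ℤ.- + weight size u ℤ.≟ j) (weight size u ≟ s)
      (λ eq → ℤ.+-injective (trans (a-x≡j⇒x≡a-j {a} eq) a-j≡s))
      (λ eq → trans (cong (λ t → a ℤ.- + t) eq) (trans (cong (λ t → a ℤ.- t) (sym a-j≡s)) (x-[x-y]≡y a j)))))
    (count-weight≡alphaSum M D s)
  by-cases -[1+ t ] a-j<0 = ∑-zero U (λ u → 𝟙-no (a ℤ.- + weight size u ℤ.≟ j)
    (λ eq → +≢negative (trans (a-x≡j⇒x≡a-j {a} eq) a-j<0)))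
    where
    +≢negative : ∀ {s} → + s ≢ -[1+ t ]
    +≢negative ()

-- The range of j

binomℤ≢0 : ∀ m z → binomℤ m z ≢ 0 → ∃ λ b → z ≡ + b × b ≤ m
binomℤ≢0 m (+ b) mCb≢0 = b , refl , ≮⇒≥ (mCb≢0 ∘ k>n⇒nCk≡0)
binomℤ≢0 m -[1+ _ ] 0≢0 = contradiction refl 0≢0

s<DR+D×DR<D+s : ∀ {q D R r₀ b s} → r₀ < q * D → b < q * D → b + q * s ≡ q * (D * R) + r₀ →
  s < D * R + D × D * R < D + s
s<DR+D×DR<D+s {q} {D} {R} {r₀} {b} {s} r₀<qD b<qD eq = s<DR+D , DR<D+s
  where
  open ≤-Reasoning
  s<DR+D : s < D * R + D
  s<DR+D = *-cancelˡ-< q s (D * R + D) (begin-strict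
    q * s                 ≤⟨ m≤n+m (q * s) b ⟩
    b + q * s             ≡⟨ eq ⟩
    q * (D * R) + r₀      <⟨ +-monoʳ-< (q * (D * R)) r₀<qD ⟩
    q * (D * R) + q * D   ≡⟨ *-distribˡ-+ q (D * R) D ⟨
    q * (D * R + D)       ∎)
  DR<D+s : D * R < D + s
  DR<D+s = *-cancelˡ-< q (D * R) (D + s) (begin-strict
    q * (D * R)           ≤⟨ m≤m+n (q * (D * R)) r₀ ⟩
    q * (D * R) + r₀      ≡⟨ eq ⟨
    b + q * s             <⟨ +-monoˡ-< (q * s) b<qD ⟩
    q * D + q * s         ≡⟨ *-distribˡ-+ q D s ⟨
    q * (D + s)           ∎)

jRange-count : ∀ D c → c < 2 * D ∸ 1 → ∑ (jRange D) (λ j → 𝟙 (j ℤ.≟ + c ℤ.- + (D ∸ 1))) ≡ 1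
jRange-count D c c<2D-1 = begin
  ∑ (jRange D) (λ j → 𝟙 (j ℤ.≟ + c ℤ.- + d))                 ≡⟨ ∑-map (upTo (2 * D ∸ 1)) _ _ ⟩
  ∑ (upTo (2 * D ∸ 1)) (λ i → 𝟙 (+ i ℤ.- + d ℤ.≟ + c ℤ.- + d)) ≡⟨ ∑-upTo (2 * D ∸ 1) _ ⟩
  ∑< (2 * D ∸ 1) (λ i → 𝟙 (+ i ℤ.- + d ℤ.≟ + c ℤ.- + d))       ≡⟨ ∑<-cong (2 * D ∸ 1) (λ i _ → shifted-index i) ⟩
  ∑< (2 * D ∸ 1) (λ i → 𝟙 (i ≟ c))                            ≡⟨ ∑<-𝟙-≡ (2 * D ∸ 1) c c<2D-1 ⟩
  1                                                           ∎
  where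
  open ≡-Reasoning
  d : ℕ
  d = D ∸ 1
  shifted-index : ∀ i → 𝟙 (+ i ℤ.- + d ℤ.≟ + c ℤ.- + d) ≡ 𝟙 (i ≟ c)
  shifted-index i = 𝟙-⇔ (+ i ℤ.- + d ℤ.≟ + c ℤ.- + d) (i ≟ c)
    (λ eq → ℤ.+-injective (x-z≡y-z⇒x≡y {z = + d} eq)) (cong (λ t → + t ℤ.- + d))

-- A nonzero binomial forces 0 ≤ r₀ + q j ≤ m₀ < q D, and with 0 ≤ r₀ < q D this gives |j| < D.
jRange-covers : ∀ {q d R r₀ m₀ s} → r₀ < q * suc d → m₀ < q * suc d →
  binomℤ m₀ (+ r₀ ℤ.+ + q ℤ.* (+ (suc d * R) ℤ.- + s)) ≢ 0 →
  ∑ (jRange (suc d)) (λ j → 𝟙 (j ℤ.≟ + (suc d * R) ℤ.- + s)) ≡ 1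
jRange-covers {q} {d} {R} {r₀} {m₀} {s} r₀<qD m₀<qD binom≢0 with binomℤ≢0 m₀ (+ r₀ ℤ.+ + q ℤ.* (+ (suc d * R) ℤ.- + s)) binom≢0
... | b , eq , b≤m₀ = subst (λ k → ∑ (jRange D) (λ j → 𝟙 (j ℤ.≟ k)) ≡ 1) (sym j≡c-d) (jRange-count D c c<2D-1)
  where
  D : ℕ
  D = suc d
  bounds : s < D * R + D × D * R < D + s
  bounds = s<DR+D×DR<D+s {q} r₀<qD (≤-<-trans b≤m₀ m₀<qD) (+r+q[a-s]≡+b⇒b+qs≡qa+r {q} {D * R} eq)
  c : ℕ
  c = D * R + d ∸ s
  c+s≡DR+d : c + s ≡ D * R + d
  c+s≡DR+d = m∸n+n≡m (s≤s⁻¹ (subst (s <_) (+-suc (D * R) d) (proj₁ bounds)))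
  j≡c-d : + (D * R) ℤ.- + s ≡ + c ℤ.- + d
  j≡c-d = [+a]-[+b]≡[+c]-[+d] (D * R) s c d (sym c+s≡DR+d)
  c<2D-1 : c < 2 * D ∸ 1
  c<2D-1 = +-cancelʳ-< s c (2 * D ∸ 1) (begin-strict
    c + s                ≡⟨ c+s≡DR+d ⟩
    D * R + d            <⟨ +-monoˡ-< d (proj₂ bounds) ⟩
    D + s + d            ≡⟨ rearrange d s ⟩
    (2 * D ∸ 1) + s      ∎)
    where
    open ≤-Reasoning
    rearrange : ∀ d s → suc d + s + d ≡ d + (suc d + 0) + s
    rearrange = ℕ-Solver.solve-∀

module _ (n M m₀ R r₀ : ℕ) .{{_ : NonZero n}} (m₀<n : m₀ < n) (r₀<n : r₀ < n) where

  jSum : (D : ℕ) .{{_ : NonZero D}} → ℕ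
  jSum D = ∑ (jRange D) (λ j → alphaSum D M (+ (D * R) ℤ.- j) * binomℤ m₀ (+ r₀ ℤ.+ + (n / D) ℤ.* j))

  fixedSum : (D : ℕ) .{{_ : NonZero D}} → ℕ
  fixedSum D = ∑ (vectors (subsets M) D) (λ u → binomℤ m₀ (+ (n * R + r₀) ℤ.- + (n / D * weight size u)))

  jSum≡fixedSum : ∀ D .{{_ : NonZero D}} → D ∣ n → jSum D ≡ fixedSum D
  jSum≡fixedSum D@(suc d) D∣n = sym (begin
    ∑ U (λ u → binomℤ m₀ (+ (n * R + r₀) ℤ.- + (q * weight size u)))
      ≡⟨ ∑-cong U (λ u → cong (binomℤ m₀) (shift-to-j (weight size u))) ⟩
    ∑ U (λ u → B (key (weight size u)))
      ≡⟨ ∑-fibres ℤ._≟_ U (jRange D) (key ∘ weight size) B (λ u → jRange-covers {q} {d} {R} {s = weight size u} r₀<qD m₀<qD) ⟩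
    ∑ (jRange D) (λ j → ∑ U (λ u → 𝟙 (key (weight size u) ℤ.≟ j)) * B j)
      ≡⟨ ∑-cong (jRange D) (λ j → cong (_* B j) (count-key≡alphaSum M D (+ (D * R)) j)) ⟩
    jSum D ∎)
    where
    open ≡-Reasoning
    U : List (Vec (Vec Bool M) D)
    U = vectors (subsets M) D
    q : ℕ
    q = n / D
    qD≡n : q * D ≡ n
    qD≡n = m/n*n≡m D∣n
    r₀<qD : r₀ < q * D
    r₀<qD = subst (r₀ <_) (sym qD≡n) r₀<n
    m₀<qD : m₀ < q * D
    m₀<qD = subst (m₀ <_) (sym qD≡n) m₀<n
    key : ℕ → ℤ
    key s = + (D * R) ℤ.- + s
    B : ℤ → ℕ
    B j = binomℤ m₀ (+ r₀ ℤ.+ + q ℤ.* j)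
    shift-to-j : ∀ s → + (n * R + r₀) ℤ.- + (q * s) ≡ + r₀ ℤ.+ + q ℤ.* key s
    shift-to-j s = begin
      + (n * R + r₀) ℤ.- + (q * s)          ≡⟨ cong (λ t → + (t + r₀) ℤ.- + (q * s)) (trans (cong (_* R) (sym qD≡n)) (*-assoc q D R)) ⟩
      + (q * (D * R) + r₀) ℤ.- + (q * s)    ≡⟨ [+[qa+r]]-[+qs]≡+r+q[a-s] q (D * R) r₀ s ⟩
      + r₀ ℤ.+ + q ℤ.* key s                ∎

  private
    _≟ₗ_ : DecidableEquality (Vec Bool M)
    _≟ₗ_ = Vec.≡-dec Bool._≟_
    W : List (Vec (Vec Bool M) n)
    W = vectors (subsets M) n

  open Burnside _≟ₗ_ n W (vectors-enumeration _≟ₗ_ (subsets M) (subsets-enumeration M) n)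

  binomOfWeight : Vec (Vec Bool M) n → ℕ
  binomOfWeight w = binomℤ m₀ (+ (n * R + r₀) ℤ.- + weight size w)

  binomOfWeight-invariant : Invariant binomOfWeight
  binomOfWeight-invariant k w = cong (λ s → binomℤ m₀ (+ (n * R + r₀) ℤ.- + s)) (weight-rotate size k w)

  ∑-fixed≡fixedSum : ∀ k → ∑ W (λ w → 𝟙 (rotate k w ≟ᵥ w) * binomOfWeight w) ≡ fixedSum (gcd k n) {{gcd-nonZero k n}}
  ∑-fixed≡fixedSum k = trans (∑-rotate-fixed _≟ₗ_ (subsets-enumeration M) k binomOfWeight)
    (∑-cong (vectors (subsets M) (gcd k n)) λ u → cong (λ s → binomℤ m₀ (+ (n * R + r₀) ℤ.- + s))
      (weight-repeat size (gcd[m,n]∣n k n) u))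
    where
    instance
      gcd≢0 : NonZero (gcd k n)
      gcd≢0 = gcd-nonZero k n

  n∣theSum : n ∣ theSum n M m₀ R r₀
  n∣theSum = subst (n ∣_) (sym theSum≡) (burnside binomOfWeight binomOfWeight-invariant)
    where
    open ≡-Reasoning
    theSum≡ : theSum n M m₀ R r₀ ≡ ∑< n (λ k → ∑ W (λ w → 𝟙 (rotate k w ≟ᵥ w) * binomOfWeight w))
    theSum≡ = begin
      theSum n M m₀ R r₀                                  ≡⟨ sumDiv-cong n (λ d d∣n → cong (φ (n / d) *_) (jSum≡fixedSum d d∣n)) ⟩
      sumDiv n (λ d → φ (n / d) * fixedSum d)             ≡⟨ ∑<-gcd≡sumDiv n fixedSum ⟨
      ∑< n (λ k → fixedSum (gcd k n) {{gcd-nonZero k n}}) ≡⟨ ∑<-cong n (λ k _ → ∑-fixed≡fixedSum k) ⟨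
      ∑< n (λ k → ∑ W (λ w → 𝟙 (rotate k w ≟ᵥ w) * binomOfWeight w)) ∎

theorem3 : (n m r : ℕ) → .{{_ : NonZero n}} →
    n ∣ theSum n (m / n) (m % n) (r / n) (r % n)
theorem3 n m r = n∣theSum n (m / n) (m % n) (r / n) (r % n) (m%n<n m n) (m%n<n r n)
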